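{- If $A\in 2^\omega$ is of prediction degree, then $A$ is weakly meager engulfing.
   Context: A predictor is a pair $P=(D,\langle \pi_n : n\in D\rangle)$ where $D\subseteq\omega$ is infinite and each $\pi_n:\omega^n\to\omega$. $P$ predicts $x\in\omega^\omega$ if for all but finitely many $n\in D$, $\pi_n(x\upharpoonright n)=x(n)$. An $A$-computable predictor is one where $D$ is $A$-computable and the map $(n,\sigma)\mapsto\pi_n(\sigma)$ is $A$-computable. $A$ is of prediction degree if some $A$-computable predictor predicts every computable function in $\omega^\omega$. An $A$-effectively meager set is a subset of a union $\bigcup_{i}C_i$ where $(C_i)_{i\in\omega}$ is a uniformly $\Pi^0_1(A)$ sequence of nowhere dense classes in $2^\omega$. $A$ is weakly meager engulfing if there is an $A$-effectively meager set containing all computable elements of $2^\omega$. -}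

module Defs where

open import Data.Nat using (ℕ; zero; suc; _+_; _≤_; _<_)
open import Data.Fin using (Fin)
open import Data.Bool using (Bool; true; false)
open import Data.List using (List; []; _∷_; map; upTo; length; _++_)
open import Data.Vec using (Vec; []; _∷_; lookup)
open import Data.Product using (Σ; ∃; ∃-syntax; _×_)
open import Relation.Binary.PropositionalEquality using (_≡_)
open import Relation.Nullary using (¬_)

tri : ℕ → ℕ
tri zero    = zero
tri (suc k) = suc k + tri k

pair : ℕ → ℕ → ℕ
pair x y = tri (x + y) + y

encode : List ℕ → ℕ
encode []       = 0
encode (x ∷ xs) = suc (pair x (encode xs))

b2n : Bool → ℕ
b2n false = 0
b2n true  = 1

prefix : {A : Set} → (ℕ → A) → ℕ → List A
prefix x n = map x (upTo n)

data Code : ℕ → Set where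
  zer  : ∀ {n} → Code n
  succ : Code 1
  proj : ∀ {n} → Fin n → Code n
  orc  : Code 1
  comp : ∀ {m n} → Code m → Vec (Code n) m → Code n
  prec : ∀ {n} → Code n → Code (suc (suc n)) → Code (suc n)
  mu   : ∀ {n} → Code (suc n) → Code n

mutual
  data Eval (f : ℕ → ℕ) : ∀ {n} → Code n → Vec ℕ n → ℕ → Set where
    e-zer  : ∀ {n} {xs : Vec ℕ n} → Eval f zer xs 0
    e-succ : ∀ {x} → Eval f succ (x ∷ []) (suc x)
    e-proj : ∀ {n} {i : Fin n} {xs} → Eval f (proj i) xs (lookup xs i)
    e-orc  : ∀ {x} → Eval f orc (x ∷ []) (f x)
    e-comp : ∀ {m n} {g : Code m} {hs : Vec (Code n) m} {xs ys y} →
             EvalAll f hs xs ys → Eval f g ys y → Eval f (comp g hs) xs y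
    e-prec0 : ∀ {n} {g : Code n} {h} {xs y} →
              Eval f g xs y → Eval f (prec g h) (0 ∷ xs) y
    e-precS : ∀ {n} {g : Code n} {h} {k xs z y} →
              Eval f (prec g h) (k ∷ xs) z → Eval f h (k ∷ z ∷ xs) y →
              Eval f (prec g h) (suc k ∷ xs) y
    e-mu   : ∀ {n} {g : Code (suc n)} {xs y} →
             Eval f g (y ∷ xs) 0 →
             (∀ z → z < y → ∃[ k ] Eval f g (z ∷ xs) (suc k)) →
             Eval f (mu g) xs y

  data EvalAll (f : ℕ → ℕ) {n : ℕ} : ∀ {m} → Vec (Code n) m → Vec ℕ n → Vec ℕ m → Set where
    ea-[] : ∀ {xs} → EvalAll f [] xs []
    ea-∷  : ∀ {m} {h : Code n} {hs : Vec (Code n) m} {xs y ys} →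
            Eval f h xs y → EvalAll f hs xs ys → EvalAll f (h ∷ hs) xs (y ∷ ys)

χ : (ℕ → Bool) → ℕ → ℕ
χ A n = b2n (A n)

Computable₁ : (ℕ → Bool) → (ℕ → ℕ) → Set
Computable₁ A g = Σ (Code 1) λ c → ∀ x → Eval (χ A) c (x ∷ []) (g x)

Computable₂ : (ℕ → Bool) → (ℕ → ℕ → ℕ) → Set
Computable₂ A g = Σ (Code 2) λ c → ∀ x y → Eval (χ A) c (x ∷ y ∷ []) (g x y)

∅ : ℕ → Bool
∅ _ = false

Computable : (ℕ → ℕ) → Set
Computable = Computable₁ ∅

record Predictor : Set where
  field
    D     : ℕ → Bool
    π     : ℕ → List ℕ → ℕ                   -- π n σ = π_n(σ) (only used for |σ| = n)
    D-inf : ∀ m → ∃[ n ] (m ≤ n × D n ≡ true)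

open Predictor public

Predicts : Predictor → (ℕ → ℕ) → Set
Predicts P x = ∃[ m ] (∀ n → m ≤ n → D P n ≡ true → π P n (prefix x n) ≡ x n)

ComputablePredictor : (ℕ → Bool) → Predictor → Set
ComputablePredictor A P =
  Computable₁ A (λ n → b2n (D P n)) ×
  Σ (Code 2) (λ c → ∀ n σ → Eval (χ A) c (n ∷ encode σ ∷ []) (π P n σ))

PredictionDegree : (ℕ → Bool) → Set
PredictionDegree A =
  Σ Predictor λ P → ComputablePredictor A P × (∀ x → Computable x → Predicts P x)

Class : (ℕ → ℕ → ℕ) → ℕ → (ℕ → Bool) → Set
Class R i X = ∀ n → R i (encode (map b2n (prefix X n))) ≡ 0

Extends : (ℕ → Bool) → List Bool → Set
Extends X ρ = prefix X (length ρ) ≡ ρ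

NowhereDense : ((ℕ → Bool) → Set) → Set
NowhereDense C = ∀ (σ : List Bool) → ∃[ τ ] (∀ X → Extends X (σ ++ τ) → ¬ C X)

record NDSeq (A : ℕ → Bool) : Set where
  field
    R      : ℕ → ℕ → ℕ
    R-comp : Computable₂ A R
    nd     : ∀ i → NowhereDense (Class R i)

open NDSeq public

EffectivelyMeager : (ℕ → Bool) → ((ℕ → Bool) → Set) → Set
EffectivelyMeager A S = Σ (NDSeq A) λ Cs → ∀ X → S X → ∃[ i ] Class (R Cs) i X

WeaklyMeagerEngulfing : (ℕ → Bool) → Set₁
WeaklyMeagerEngulfing A =
  Σ ((ℕ → Bool) → Set) λ S →
    EffectivelyMeager A S × (∀ X → Computable (λ n → b2n (X n)) → S X)

module Submission where

-- Let P = (D, π) be an A-computable predictor predicting every computable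
-- x ∈ ω^ω, and let C_i = { X | π_n(X↾n) = X(n) for all n ≥ i with n ∈ D }.
-- Every computable X is predicted from some i on, so X ∈ C_i.  Each C_i is
-- nowhere dense: pad any string σ with zeros to a length n ≥ i with n ∈ D
-- and append the bit contradicting π_n.  And C_i is Π⁰₁(A) uniformly in i:
-- X ∈ C_i iff badness(i, X↾L) = 0 for all L, where badness(i, ρ) is a
-- product that vanishes iff the last bit of ρ is correctly predicted or
-- lies at a position below i or outside D.

open import Defs
open import Data.Bool using (Bool; true; false)
open import Data.Empty using (⊥-elim)
open import Data.Fin using (Fin; zero; suc)
open import Data.List using (List; []; _∷_; _++_; _∷ʳ_; length; map; drop; replicate; upTo)
open import Data.List.Properties
  using (length-++; length-map; length-upTo; length-replicate; length-drop; drop-drop; drop-all; map-++; map-∘; ++-assoc; ∷ʳ-injective; applyUpTo-∷ʳ)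
open import Data.Nat using (ℕ; zero; suc; pred; _+_; _∸_; _*_; _≤_; _<_; z≤n; s≤s; s≤s⁻¹; _≟_; _≤?_; ∣_-_∣)
open import Data.Nat.Properties
open import Data.Product using (Σ; ∃-syntax; _×_; _,_; proj₁; proj₂)
open import Data.Sum using (_⊎_; inj₁; inj₂)
open import Data.Vec using (Vec; []; _∷_; lookup)
open import Function using (_∘′_)
open import Relation.Nullary using (¬_; Dec; yes; no)
open import Relation.Binary.Definitions using (tri<; tri≈; tri>)
open import Relation.Binary.PropositionalEquality

private variable
  n : ℕ
  f : ℕ → ℕ

Least : (ℕ → Set) → ℕ → Set
Least P m = P m × (∀ z → z < m → ¬ P z)

module _ {P : ℕ → Set} (P? : ∀ m → Dec (P m)) where

  searchBelow : ∀ m → Σ ℕ (Least P) ⊎ (∀ z → z < m → ¬ P z)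
  searchBelow zero = inj₂ (λ _ ())
  searchBelow (suc m) with searchBelow m
  ... | inj₁ found = inj₁ found
  ... | inj₂ none with P? m
  ...   | yes p = inj₁ (m , p , none)
  ...   | no ¬p = inj₂ noneBelowSuc
    where
    noneBelowSuc : ∀ z → z < suc m → ¬ P z
    noneBelowSuc z z<1+m with m≤n⇒m<n∨m≡n (s≤s⁻¹ z<1+m)
    ... | inj₁ z<m = none z z<m
    ... | inj₂ refl = ¬p

  least : ∀ {m} → P m → Σ ℕ (Least P)
  least {m} p with searchBelow m
  ... | inj₁ found = found
  ... | inj₂ none = m , p , none

least-unique : ∀ {P a b} → Least P a → Least P b → a ≡ b
least-unique {a = a} {b} (pa , below-a) (pb , below-b) with <-cmp a b
... | tri< a<b _ _ = ⊥-elim (below-b a a<b pa)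
... | tri≈ _ a≡b _ = a≡b
... | tri> _ _ b<a = ⊥-elim (below-a b b<a pb)

Computes : (ℕ → ℕ) → Code n → (Vec ℕ n → ℕ) → Set
Computes f c F = ∀ xs → Eval f c xs (F xs)

Computes₁ : (ℕ → ℕ) → Code 1 → (ℕ → ℕ) → Set
Computes₁ f c F = Computes f c (λ xs → F (lookup xs zero))

Computes₂ : (ℕ → ℕ) → Code 2 → (ℕ → ℕ → ℕ) → Set
Computes₂ f c F = Computes f c (λ xs → F (lookup xs zero) (lookup xs (suc zero)))

computes-ext : ∀ {c : Code n} {F G} → Computes f c F → (∀ xs → F xs ≡ G xs) → Computes f c G
computes-ext c-ok F≗G xs = subst (Eval _ _ xs) (F≗G xs) (c-ok xs)

#0 : Code (suc n)
#0 = proj zero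

#1 : Code (suc (suc n))
#1 = proj (suc zero)

#2 : Code (suc (suc (suc n)))
#2 = proj (suc (suc zero))

#3 : Code (suc (suc (suc (suc n))))
#3 = proj (suc (suc (suc zero)))

zer-ok : Computes {n} f zer (λ _ → 0)
zer-ok _ = e-zer

succ-ok : Computes₁ f succ suc
succ-ok (_ ∷ []) = e-succ

proj-ok : (i : Fin n) → Computes f (proj i) (λ xs → lookup xs i)
proj-ok _ _ = e-proj

comp₁ : Code 1 → Code n → Code n
comp₁ g h = comp g (h ∷ [])

comp₂ : Code 2 → Code n → Code n → Code n
comp₂ g h k = comp g (h ∷ k ∷ [])

comp₃ : Code 3 → Code n → Code n → Code n → Code n
comp₃ g h k l = comp g (h ∷ k ∷ l ∷ [])

comp₁-ok : ∀ {g h G} {H : Vec ℕ n → ℕ} → Computes f g G → Computes f h H →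
           Computes f (comp₁ g h) (λ xs → G (H xs ∷ []))
comp₁-ok g-ok h-ok xs = e-comp (ea-∷ (h-ok xs) ea-[]) (g-ok _)

comp₂-ok : ∀ {g h k G} {H K : Vec ℕ n → ℕ} → Computes f g G → Computes f h H → Computes f k K →
           Computes f (comp₂ g h k) (λ xs → G (H xs ∷ K xs ∷ []))
comp₂-ok g-ok h-ok k-ok xs = e-comp (ea-∷ (h-ok xs) (ea-∷ (k-ok xs) ea-[])) (g-ok _)

comp₃-ok : ∀ {g h k l G} {H K L : Vec ℕ n → ℕ} → Computes f g G → Computes f h H → Computes f k K → Computes f l L →
           Computes f (comp₃ g h k l) (λ xs → G (H xs ∷ K xs ∷ L xs ∷ []))
comp₃-ok g-ok h-ok k-ok l-ok xs = e-comp (ea-∷ (h-ok xs) (ea-∷ (k-ok xs) (ea-∷ (l-ok xs) ea-[]))) (g-ok _)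

prec-ok : ∀ {g : Code n} {h G H} (F : Vec ℕ (suc n) → ℕ) → Computes f g G → Computes f h H →
          (∀ xs → F (0 ∷ xs) ≡ G xs) → (∀ k xs → F (suc k ∷ xs) ≡ H (k ∷ F (k ∷ xs) ∷ xs)) →
          Computes f (prec g h) F
prec-ok F g-ok h-ok base step (zero ∷ xs) =
  subst (Eval _ _ _) (sym (base xs)) (e-prec0 (g-ok xs))
prec-ok F g-ok h-ok base step (suc k ∷ xs) =
  subst (Eval _ _ _) (sym (step k xs)) (e-precS (prec-ok F g-ok h-ok base step (k ∷ xs)) (h-ok _))

HasZeros : (Vec ℕ (suc n) → ℕ) → Set
HasZeros G = ∀ xs → ∃[ y ] G (y ∷ xs) ≡ 0

IsLeastZero : (Vec ℕ (suc n) → ℕ) → Vec ℕ n → ℕ → Set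
IsLeastZero G xs = Least (λ y → G (y ∷ xs) ≡ 0)

minimise : (G : Vec ℕ (suc n) → ℕ) → HasZeros G → Vec ℕ n → ℕ
minimise G zeros xs = proj₁ (least (λ y → G (y ∷ xs) ≟ 0) (proj₂ (zeros xs)))

minimise-least : ∀ G (zeros : HasZeros {n} G) xs → IsLeastZero G xs (minimise G zeros xs)
minimise-least G zeros xs = proj₂ (least (λ y → G (y ∷ xs) ≟ 0) (proj₂ (zeros xs)))

minimise-unique : ∀ G (zeros : HasZeros {n} G) xs {y} → IsLeastZero G xs y → minimise G zeros xs ≡ y
minimise-unique G zeros xs = least-unique (minimise-least G zeros xs)

-- `mu g` computes the minimisation of G; e-mu asks for the values of G below
-- the result as successors.
mu-ok : ∀ {g : Code (suc n)} {G} (zeros : HasZeros G) → Computes f g G → Computes f (mu g) (minimise G zeros)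
mu-ok {f = f} {G = G} zeros g-ok xs =
  e-mu (subst (Eval _ _ _) isZero (g-ok _)) (λ z z<y → nonzero (g-ok (z ∷ xs)) (below z z<y))
  where
  isZero = proj₁ (minimise-least G zeros xs)
  below = proj₂ (minimise-least G zeros xs)
  nonzero : ∀ {c : Code (suc n)} {ys v} → Eval f c ys v → ¬ v ≡ 0 → ∃[ k ] Eval f c ys (suc k)
  nonzero {v = zero} _ v≢0 = ⊥-elim (v≢0 refl)
  nonzero {v = suc k} e _ = k , e

predᶜ : Code 1
predᶜ = prec zer #0

predᶜ-ok : Computes₁ f predᶜ pred
predᶜ-ok = prec-ok _ zer-ok (proj-ok _) (λ _ → refl) (λ _ _ → refl)

addᶜ : Code 2
addᶜ = prec #0 (comp₁ succ #1)

addᶜ-ok : Computes₂ f addᶜ _+_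
addᶜ-ok = prec-ok _ (proj-ok _) (comp₁-ok succ-ok (proj-ok _)) (λ _ → refl) (λ _ _ → refl)

subtractFromᶜ : Code 2
subtractFromᶜ = prec #0 (comp₁ predᶜ #1)

subtractFromᶜ-ok : Computes₂ f subtractFromᶜ (λ b a → a ∸ b)
subtractFromᶜ-ok = prec-ok _ (proj-ok _) (comp₁-ok predᶜ-ok (proj-ok _)) (λ _ → refl)
  (λ k xs → sym (pred[m∸n]≡m∸[1+n] (lookup xs zero) k))

monusᶜ : Code 2
monusᶜ = comp₂ subtractFromᶜ #1 #0

monusᶜ-ok : Computes₂ f monusᶜ _∸_
monusᶜ-ok = comp₂-ok subtractFromᶜ-ok (proj-ok _) (proj-ok _)

mulᶜ : Code 2
mulᶜ = prec zer (comp₂ addᶜ #2 #1)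

mulᶜ-ok : Computes₂ f mulᶜ _*_
mulᶜ-ok = prec-ok _ zer-ok (comp₂-ok addᶜ-ok (proj-ok _) (proj-ok _)) (λ _ → refl) (λ _ _ → refl)

∣-∣≡∸+∸ : ∀ a b → ∣ a - b ∣ ≡ (a ∸ b) + (b ∸ a)
∣-∣≡∸+∸ zero b = sym (cong (_+ b) (0∸n≡0 b))
∣-∣≡∸+∸ (suc a) zero = sym (+-identityʳ (suc a))
∣-∣≡∸+∸ (suc a) (suc b) = ∣-∣≡∸+∸ a b

distᶜ : Code 2
distᶜ = comp₂ addᶜ monusᶜ (comp₂ monusᶜ #1 #0)

distᶜ-ok : Computes₂ f distᶜ ∣_-_∣
distᶜ-ok = computes-ext (comp₂-ok addᶜ-ok monusᶜ-ok (comp₂-ok monusᶜ-ok (proj-ok _) (proj-ok _)))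
  (λ { (a ∷ b ∷ []) → sym (∣-∣≡∸+∸ a b) })

triᶜ : Code 1
triᶜ = prec zer (comp₂ addᶜ (comp₁ succ #0) #1)

triᶜ-ok : Computes₁ f triᶜ tri
triᶜ-ok = prec-ok _ zer-ok (comp₂-ok addᶜ-ok (comp₁-ok succ-ok (proj-ok _)) (proj-ok _))
  (λ _ → refl) (λ _ _ → refl)

pairᶜ : Code 2
pairᶜ = comp₂ addᶜ (comp₁ triᶜ addᶜ) #1

pairᶜ-ok : Computes₂ f pairᶜ pair
pairᶜ-ok = comp₂-ok addᶜ-ok (comp₁-ok triᶜ-ok addᶜ-ok) (proj-ok _)

-- Inverting the Cantor pairing.  The diagonal of c is the least s with
-- c < tri (suc s); for c = pair x y it is x + y, and the two components are
-- then recovered by subtraction.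

n≤tri : ∀ m → m ≤ tri m
n≤tri zero = z≤n
n≤tri (suc m) = m≤m+n (suc m) (tri m)

tri-mono : ∀ {m k} → m ≤ k → tri m ≤ tri k
tri-mono {zero} _ = z≤n
tri-mono {suc m} {suc k} (s≤s m≤k) = +-mono-≤ (s≤s m≤k) (tri-mono m≤k)

-- (s , c) ↦ 0  iff  c < tri (suc s)
diagonalTest : Vec ℕ 2 → ℕ
diagonalTest xs = suc (lookup xs (suc zero)) ∸ tri (suc (lookup xs zero))

diagonalTest-zeros : HasZeros diagonalTest
diagonalTest-zeros (c ∷ []) = c , m≤n⇒m∸n≡0 (n≤tri (suc c))

diagonal : ℕ → ℕ
diagonal c = minimise diagonalTest diagonalTest-zeros (c ∷ [])

-- pair x y lies on diagonal x + y: tri (x + y) ≤ pair x y < tri (suc (x + y)).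
diagonal-pair : ∀ x y → diagonal (pair x y) ≡ x + y
diagonal-pair x y = minimise-unique diagonalTest diagonalTest-zeros (pair x y ∷ []) (below-next , above-earlier)
  where
  below-next : suc (pair x y) ∸ tri (suc (x + y)) ≡ 0
  below-next = m≤n⇒m∸n≡0 (s≤s (≤-trans (+-monoʳ-≤ (tri (x + y)) (m≤n+m y x))
                                       (≤-reflexive (+-comm (tri (x + y)) (x + y)))))
  above-earlier : ∀ z → z < x + y → ¬ suc (pair x y) ∸ tri (suc z) ≡ 0
  above-earlier z z<x+y = m>n⇒m∸n≢0 (s≤s (≤-trans (tri-mono z<x+y) (m≤m+n (tri (x + y)) y)))

unpair₁ unpair₂ : ℕ → ℕ
unpair₂ c = c ∸ tri (diagonal c)
unpair₁ c = diagonal c ∸ unpair₂ c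

unpair₂-pair : ∀ x y → unpair₂ (pair x y) ≡ y
unpair₂-pair x y = begin
  pair x y ∸ tri (diagonal (pair x y))  ≡⟨ cong (λ s → pair x y ∸ tri s) (diagonal-pair x y) ⟩
  tri (x + y) + y ∸ tri (x + y)         ≡⟨ m+n∸m≡n (tri (x + y)) y ⟩
  y                                     ∎
  where open ≡-Reasoning

unpair₁-pair : ∀ x y → unpair₁ (pair x y) ≡ x
unpair₁-pair x y = begin
  diagonal (pair x y) ∸ unpair₂ (pair x y)  ≡⟨ cong₂ _∸_ (diagonal-pair x y) (unpair₂-pair x y) ⟩
  x + y ∸ y                                 ≡⟨ m+n∸n≡m x y ⟩
  x                                         ∎
  where open ≡-Reasoning

diagonalᶜ : Code 1
diagonalᶜ = mu (comp₂ monusᶜ (comp₁ succ #1) (comp₁ triᶜ (comp₁ succ #0)))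

diagonalᶜ-ok : Computes₁ f diagonalᶜ diagonal
diagonalᶜ-ok = computes-ext
  (mu-ok diagonalTest-zeros (comp₂-ok monusᶜ-ok (comp₁-ok succ-ok (proj-ok _))
                                                (comp₁-ok triᶜ-ok (comp₁-ok succ-ok (proj-ok _)))))
  (λ { (_ ∷ []) → refl })

unpair₁ᶜ unpair₂ᶜ : Code 1
unpair₂ᶜ = comp₂ monusᶜ #0 (comp₁ triᶜ diagonalᶜ)
unpair₁ᶜ = comp₂ monusᶜ diagonalᶜ unpair₂ᶜ

unpair₂ᶜ-ok : Computes₁ f unpair₂ᶜ unpair₂
unpair₂ᶜ-ok = comp₂-ok monusᶜ-ok (proj-ok _) (comp₁-ok triᶜ-ok diagonalᶜ-ok)

unpair₁ᶜ-ok : Computes₁ f unpair₁ᶜ unpair₁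
unpair₁ᶜ-ok = comp₂-ok monusᶜ-ok diagonalᶜ-ok unpair₂ᶜ-ok

-- Decoding Cantor-coded lists.  encode (x ∷ s) = suc (pair x (encode s)),
-- so head and tail come from unpairing; iterating the tail drops a prefix;
-- the length is the least number of drops reaching the empty list; and
-- elements, windows of consecutive elements, the initial segment and the
-- last element are read off from these.

decHead decTail : ℕ → ℕ
decHead c = unpair₁ (pred c)
decTail c = unpair₂ (pred c)

decHead-∷ : ∀ x s → decHead (encode (x ∷ s)) ≡ x
decHead-∷ x s = unpair₁-pair x (encode s)

decTail-encode : ∀ s → decTail (encode s) ≡ encode (drop 1 s)
decTail-encode [] = 0∸n≡0 (tri (diagonal 0))
decTail-encode (x ∷ s) = unpair₂-pair x (encode s)

decTail-≤ : ∀ c → decTail c ≤ pred c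
decTail-≤ c = m∸n≤m (pred c) (tri (diagonal (pred c)))

decDrop : ℕ → ℕ → ℕ
decDrop zero c = c
decDrop (suc k) c = decTail (decDrop k c)

decDrop-encode : ∀ k s → decDrop k (encode s) ≡ encode (drop k s)
decDrop-encode zero s = refl
decDrop-encode (suc k) s = begin
  decTail (decDrop k (encode s))  ≡⟨ cong decTail (decDrop-encode k s) ⟩
  decTail (encode (drop k s))     ≡⟨ decTail-encode (drop k s) ⟩
  encode (drop 1 (drop k s))      ≡⟨ cong encode (drop-drop k 1 s) ⟩
  encode (drop (k + 1) s)         ≡⟨ cong (λ m → encode (drop m s)) (+-comm k 1) ⟩
  encode (drop (suc k) s)         ∎
  where open ≡-Reasoning

-- Each tail step decreases a nonzero number, so c drops always reach 0;
-- this makes the length search below total on all of ℕ.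
decDrop-≤ : ∀ k c → decDrop k c ≤ c ∸ k
decDrop-≤ zero c = ≤-refl
decDrop-≤ (suc k) c = begin
  decTail (decDrop k c)  ≤⟨ decTail-≤ (decDrop k c) ⟩
  pred (decDrop k c)     ≤⟨ pred-mono-≤ (decDrop-≤ k c) ⟩
  pred (c ∸ k)           ≡⟨ pred[m∸n]≡m∸[1+n] c k ⟩
  c ∸ suc k              ∎
  where open ≤-Reasoning

decLengthTest : Vec ℕ 2 → ℕ
decLengthTest xs = decDrop (lookup xs zero) (lookup xs (suc zero))

decLengthTest-zeros : HasZeros decLengthTest
decLengthTest-zeros (c ∷ []) = c , n≤0⇒n≡0 (≤-trans (decDrop-≤ c c) (≤-reflexive (n∸n≡0 c)))

decLength : ℕ → ℕ
decLength c = minimise decLengthTest decLengthTest-zeros (c ∷ [])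

encode≡0⇒[] : ∀ {s} → encode s ≡ 0 → s ≡ []
encode≡0⇒[] {[]} _ = refl

decLength-encode : ∀ s → decLength (encode s) ≡ length s
decLength-encode s = minimise-unique decLengthTest decLengthTest-zeros (encode s ∷ []) (allDropped , notYet)
  where
  allDropped : decDrop (length s) (encode s) ≡ 0
  allDropped = trans (decDrop-encode (length s) s) (cong encode (drop-all (length s) s ≤-refl))
  notYet : ∀ z → z < length s → ¬ decDrop z (encode s) ≡ 0
  notYet z z<len dropped = m>n⇒m∸n≢0 z<len (begin
    length s ∸ z       ≡⟨ length-drop z s ⟨
    length (drop z s)  ≡⟨ cong length (encode≡0⇒[] (trans (sym (decDrop-encode z s)) dropped)) ⟩
    0                  ∎)
    where open ≡-Reasoning

decLength-∷ʳ : ∀ s x → decLength (encode (s ∷ʳ x)) ≡ suc (length s)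
decLength-∷ʳ s x = trans (decLength-encode (s ∷ʳ x)) (trans (length-++ s) (+-comm (length s) 1))

decElem : ℕ → ℕ → ℕ
decElem j c = decHead (decDrop j c)

drop-length-++ : ∀ (p q : List ℕ) → drop (length p) (p ++ q) ≡ q
drop-length-++ [] q = refl
drop-length-++ (_ ∷ p) q = drop-length-++ p q

decElem-encode : ∀ p x q → decElem (length p) (encode (p ++ x ∷ q)) ≡ x
decElem-encode p x q = begin
  decHead (decDrop (length p) (encode (p ++ x ∷ q)))  ≡⟨ cong decHead (decDrop-encode (length p) (p ++ x ∷ q)) ⟩
  decHead (encode (drop (length p) (p ++ x ∷ q)))     ≡⟨ cong (decHead ∘′ encode) (drop-length-++ p (x ∷ q)) ⟩
  decHead (encode (x ∷ q))                            ≡⟨ decHead-∷ x q ⟩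
  x                                                   ∎
  where open ≡-Reasoning

decWindow : ℕ → ℕ → ℕ → List ℕ
decWindow zero e c = []
decWindow (suc k) e c = decElem (e ∸ suc k) c ∷ decWindow k e c

decWindow-encode : ∀ p w q → decWindow (length w) (length p + length w) (encode (p ++ w ++ q)) ≡ w
decWindow-encode p [] q = refl
decWindow-encode p (x ∷ w) q = cong₂ _∷_ first rest
  where
  first : decElem (length p + suc (length w) ∸ suc (length w)) (encode (p ++ x ∷ w ++ q)) ≡ x
  first = trans (cong (λ j → decElem j (encode (p ++ x ∷ w ++ q))) (m+n∸n≡m (length p) (suc (length w))))
                (decElem-encode p x (w ++ q))
  shift : length (p ∷ʳ x) + length w ≡ length p + suc (length w)
  shift = trans (cong (_+ length w) (length-++ p)) (+-assoc (length p) 1 (length w))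
  reassociate : encode ((p ∷ʳ x) ++ w ++ q) ≡ encode (p ++ x ∷ w ++ q)
  reassociate = cong encode (++-assoc p (x ∷ []) (w ++ q))
  rest : decWindow (length w) (length p + suc (length w)) (encode (p ++ x ∷ w ++ q)) ≡ w
  rest = subst₂ (λ e c → decWindow (length w) e c ≡ w) shift reassociate (decWindow-encode (p ∷ʳ x) w q)

decInit : ℕ → List ℕ
decInit c = decWindow (pred (decLength c)) (pred (decLength c)) c

decLast : ℕ → ℕ
decLast c = decElem (pred (decLength c)) c

decInit-∷ʳ : ∀ s x → decInit (encode (s ∷ʳ x)) ≡ s
decInit-∷ʳ s x = trans (cong (λ m → decWindow (pred m) (pred m) (encode (s ∷ʳ x))) (decLength-∷ʳ s x))
                       (decWindow-encode [] s (x ∷ []))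

decLast-∷ʳ : ∀ s x → decLast (encode (s ∷ʳ x)) ≡ x
decLast-∷ʳ s x = trans (cong (λ m → decElem (pred m) (encode (s ∷ʳ x))) (decLength-∷ʳ s x))
                       (decElem-encode s x [])

decHeadᶜ decTailᶜ : Code 1
decHeadᶜ = comp₁ unpair₁ᶜ predᶜ
decTailᶜ = comp₁ unpair₂ᶜ predᶜ

decHeadᶜ-ok : Computes₁ f decHeadᶜ decHead
decHeadᶜ-ok = comp₁-ok unpair₁ᶜ-ok predᶜ-ok

decTailᶜ-ok : Computes₁ f decTailᶜ decTail
decTailᶜ-ok = comp₁-ok unpair₂ᶜ-ok predᶜ-ok

decDropᶜ : Code 2
decDropᶜ = prec #0 (comp₁ decTailᶜ #1)

decDropᶜ-ok : Computes₂ f decDropᶜ decDrop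
decDropᶜ-ok = prec-ok _ (proj-ok _) (comp₁-ok decTailᶜ-ok (proj-ok _)) (λ _ → refl) (λ _ _ → refl)

decLengthᶜ : Code 1
decLengthᶜ = mu decDropᶜ

decLengthᶜ-ok : Computes₁ f decLengthᶜ decLength
decLengthᶜ-ok = computes-ext (mu-ok decLengthTest-zeros decDropᶜ-ok) (λ { (_ ∷ []) → refl })

decElemᶜ : Code 2
decElemᶜ = comp₁ decHeadᶜ decDropᶜ

decElemᶜ-ok : Computes₂ f decElemᶜ decElem
decElemᶜ-ok = comp₁-ok decHeadᶜ-ok decDropᶜ-ok

decWindowᶜ : Code 3
decWindowᶜ = prec zer (comp₁ succ (comp₂ pairᶜ (comp₂ decElemᶜ (comp₂ monusᶜ #2 (comp₁ succ #0)) #3) #1))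

decWindowᶜ-ok : Computes f decWindowᶜ (λ xs → encode (decWindow (lookup xs zero) (lookup xs (suc zero)) (lookup xs (suc (suc zero)))))
decWindowᶜ-ok = prec-ok _ zer-ok
  (comp₁-ok succ-ok (comp₂-ok pairᶜ-ok (comp₂-ok decElemᶜ-ok (comp₂-ok monusᶜ-ok (proj-ok _) (comp₁-ok succ-ok (proj-ok _)))
                                                             (proj-ok _))
                                       (proj-ok _)))
  (λ _ → refl) (λ _ _ → refl)

lastIndexᶜ : Code 1
lastIndexᶜ = comp₁ predᶜ decLengthᶜ

lastIndexᶜ-ok : Computes₁ f lastIndexᶜ (λ c → pred (decLength c))
lastIndexᶜ-ok = comp₁-ok predᶜ-ok decLengthᶜ-ok

decInitᶜ decLastᶜ : Code 1
decInitᶜ = comp₃ decWindowᶜ lastIndexᶜ lastIndexᶜ #0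
decLastᶜ = comp₂ decElemᶜ lastIndexᶜ #0

decInitᶜ-ok : Computes₁ f decInitᶜ (λ c → encode (decInit c))
decInitᶜ-ok = comp₃-ok decWindowᶜ-ok lastIndexᶜ-ok lastIndexᶜ-ok (proj-ok _)

decLastᶜ-ok : Computes₁ f decLastᶜ decLast
decLastᶜ-ok = comp₂-ok decElemᶜ-ok lastIndexᶜ-ok (proj-ok _)

prefix-suc : ∀ {B : Set} (x : ℕ → B) m → prefix x (suc m) ≡ prefix x m ∷ʳ x m
prefix-suc x m = begin
  map x (upTo (suc m))        ≡⟨ cong (map x) (applyUpTo-∷ʳ (λ k → k) m) ⟨
  map x (upTo m ∷ʳ m)         ≡⟨ map-++ x (upTo m) (m ∷ []) ⟩
  map x (upTo m) ∷ʳ x m       ∎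
  where open ≡-Reasoning

extends-∷ʳ : ∀ (X : ℕ → Bool) ρ b → Extends X (ρ ∷ʳ b) → prefix X (length ρ) ≡ ρ × X (length ρ) ≡ b
extends-∷ʳ X ρ b ext = ∷ʳ-injective (prefix X (length ρ)) ρ (begin
  prefix X (length ρ) ∷ʳ X (length ρ)  ≡⟨ prefix-suc X (length ρ) ⟨
  prefix X (suc (length ρ))            ≡⟨ cong (prefix X) (trans (+-comm 1 (length ρ)) (sym (length-++ ρ))) ⟩
  prefix X (length (ρ ∷ʳ b))           ≡⟨ ext ⟩
  ρ ∷ʳ b                               ∎)
  where open ≡-Reasoning

bits : (ℕ → Bool) → ℕ → List ℕ
bits X m = map b2n (prefix X m)

charSeq : (ℕ → Bool) → ℕ → ℕ
charSeq X m = b2n (X m)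

prefix-charSeq : ∀ X m → prefix (charSeq X) m ≡ bits X m
prefix-charSeq X m = map-∘ (upTo m)

bits-suc : ∀ X m → bits X (suc m) ≡ bits X m ∷ʳ b2n (X m)
bits-suc X m = trans (cong (map b2n) (prefix-suc X m)) (map-++ b2n (prefix X m) (X m ∷ []))

length-bits : ∀ X m → length (bits X m) ≡ m
length-bits X m = trans (length-map b2n (prefix X m)) (trans (length-map X (upTo m)) (length-upTo m))

contradict : ℕ → Bool
contradict zero = true
contradict (suc _) = false

contradict-differs : ∀ v → ¬ v ≡ b2n (contradict v)
contradict-differs zero ()
contradict-differs (suc v) ()

*-≢0 : ∀ {a b} → ¬ a ≡ 0 → ¬ b ≡ 0 → ¬ a * b ≡ 0
*-≢0 {a} a≢0 b≢0 ab≡0 with m*n≡0⇒m≡0∨n≡0 a ab≡0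
... | inj₁ a≡0 = a≢0 a≡0
... | inj₂ b≡0 = b≢0 b≡0

module Engulfing (A : ℕ → Bool) (P : Predictor) (P-computable : ComputablePredictor A P) where

  -- The error made at the last position L - 1 of a string σ ∷ʳ b of
  -- length L: nonzero iff L - 1 ≥ i, L - 1 ∈ D and π_{L-1}(σ) ≠ b.
  errorAt : ℕ → ℕ → List ℕ → ℕ → ℕ
  errorAt i L σ b = ((L ∸ i) * b2n (D P (pred L))) * ∣ π P (pred L) σ - b ∣

  correct⇒errorAt≡0 : ∀ i n σ b → (i ≤ n → D P n ≡ true → π P n σ ≡ b) → errorAt i (suc n) σ b ≡ 0
  correct⇒errorAt≡0 i n σ b correct with i ≤? n | D P n
  ... | no i≰n | _ rewrite m≤n⇒m∸n≡0 (≰⇒> i≰n) = refl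
  ... | yes _ | false = cong (_* ∣ π P n σ - b ∣) (*-zeroʳ (suc n ∸ i))
  ... | yes i≤n | true rewrite correct i≤n refl | ∣n-n∣≡0 b = *-zeroʳ ((suc n ∸ i) * 1)

  wrong⇒errorAt≢0 : ∀ i n σ b → i ≤ n → D P n ≡ true → ¬ π P n σ ≡ b → ¬ errorAt i (suc n) σ b ≡ 0
  wrong⇒errorAt≢0 i n σ b i≤n n∈D wrong =
    *-≢0 (*-≢0 (m>n⇒m∸n≢0 (s≤s i≤n)) (λ D≡0 → 1≢0 (trans (cong b2n (sym n∈D)) D≡0)))
         (λ dist≡0 → wrong (∣m-n∣≡0⇒m≡n dist≡0))
    where
    1≢0 : ¬ 1 ≡ 0
    1≢0 ()

  badness : ℕ → ℕ → ℕ
  badness i c = errorAt i (decLength c) (decInit c) (decLast c)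

  badness-[] : ∀ i → badness i (encode []) ≡ 0
  badness-[] i = begin
    errorAt i (decLength 0) (decInit 0) (decLast 0)  ≡⟨ cong (λ L → errorAt i L (decInit 0) (decLast 0)) (decLength-encode []) ⟩
    errorAt i 0 (decInit 0) (decLast 0)              ≡⟨ cong (λ t → (t * b2n (D P 0)) * ∣ π P 0 (decInit 0) - decLast 0 ∣) (0∸n≡0 i) ⟩
    0                                                ∎
    where open ≡-Reasoning

  badness-bits : ∀ i X m → badness i (encode (bits X (suc m))) ≡ errorAt i (suc m) (bits X m) (b2n (X m))
  badness-bits i X m = begin
    badness i (encode (bits X (suc m)))                   ≡⟨ cong (badness i ∘′ encode) (bits-suc X m) ⟩
    errorAt i (decLength c) (decInit c) (decLast c)       ≡⟨ cong (λ L → errorAt i L (decInit c) (decLast c)) (decLength-∷ʳ σ x) ⟩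
    errorAt i (suc (length σ)) (decInit c) (decLast c)    ≡⟨ cong₂ (errorAt i (suc (length σ))) (decInit-∷ʳ σ x) (decLast-∷ʳ σ x) ⟩
    errorAt i (suc (length σ)) σ x                        ≡⟨ cong (λ L → errorAt i (suc L) σ x) (length-bits X m) ⟩
    errorAt i (suc m) σ x                                 ∎
    where
    open ≡-Reasoning
    σ = bits X m
    x = b2n (X m)
    c = encode (σ ∷ʳ x)

  badness-computable : Computable₂ A badness
  badness-computable = badnessᶜ , λ i c → badnessᶜ-ok (i ∷ c ∷ [])
    where
    Dᶜ = proj₁ (proj₁ P-computable)
    πᶜ = proj₁ (proj₂ P-computable)

    Dᶜ-ok : Computes₁ (χ A) Dᶜ (λ m → b2n (D P m))
    Dᶜ-ok (m ∷ []) = proj₂ (proj₁ P-computable) m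

    predictionᶜ : Code 1
    predictionᶜ = comp₂ πᶜ lastIndexᶜ decInitᶜ

    predictionᶜ-ok : Computes₁ (χ A) predictionᶜ (λ c → π P (pred (decLength c)) (decInit c))
    predictionᶜ-ok xs = e-comp (ea-∷ (lastIndexᶜ-ok xs) (ea-∷ (decInitᶜ-ok xs) ea-[])) (proj₂ (proj₂ P-computable) _ _)

    badnessᶜ : Code 2
    badnessᶜ = comp₂ mulᶜ (comp₂ mulᶜ (comp₂ monusᶜ (comp₁ decLengthᶜ #1) #0) (comp₁ Dᶜ (comp₁ lastIndexᶜ #1)))
                          (comp₂ distᶜ (comp₁ predictionᶜ #1) (comp₁ decLastᶜ #1))

    badnessᶜ-ok : Computes₂ (χ A) badnessᶜ badness
    badnessᶜ-ok = comp₂-ok mulᶜ-ok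
      (comp₂-ok mulᶜ-ok (comp₂-ok monusᶜ-ok (comp₁-ok decLengthᶜ-ok (proj-ok _)) (proj-ok _))
                        (comp₁-ok Dᶜ-ok (comp₁-ok lastIndexᶜ-ok (proj-ok _))))
      (comp₂-ok distᶜ-ok (comp₁-ok predictionᶜ-ok (proj-ok _)) (comp₁-ok decLastᶜ-ok (proj-ok _)))

  predicted⇒covered : ∀ X → Predicts P (charSeq X) → ∃[ i ] Class badness i X
  predicted⇒covered X (m , correctFrom) = m , noError
    where
    noError : ∀ L → badness m (encode (bits X L)) ≡ 0
    noError zero = badness-[] m
    noError (suc n) = trans (badness-bits m X n) (correct⇒errorAt≡0 m n (bits X n) (b2n (X n))
      (λ m≤n n∈D → trans (cong (π P n) (sym (prefix-charSeq X n))) (correctFrom n m≤n n∈D)))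

  -- Each C_i is nowhere dense: pad σ with zeros up to a position pos ≥ i in D,
  -- then append the bit contradicting π_pos.
  nowhereDense : ∀ i → NowhereDense (Class badness i)
  nowhereDense i σ = padding ∷ʳ b , avoids
    where
    k = length σ
    pos = proj₁ (D-inf P (i + k))
    i+k≤pos = proj₁ (proj₂ (D-inf P (i + k)))
    pos∈D = proj₂ (proj₂ (D-inf P (i + k)))
    padding = replicate (pos ∸ k) false
    ρ = σ ++ padding
    b = contradict (π P pos (map b2n ρ))

    |ρ|≡pos : length ρ ≡ pos
    |ρ|≡pos = trans (length-++ σ) (trans (cong (k +_) (length-replicate (pos ∸ k)))
                                       (m+[n∸m]≡n (≤-trans (m≤n+m k i) i+k≤pos)))

    avoids : ∀ X → Extends X (σ ++ padding ∷ʳ b) → ¬ Class badness i X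
    avoids X ext inClass =
      wrong⇒errorAt≢0 i pos (bits X pos) (b2n (X pos)) (≤-trans (m≤m+n i k) i+k≤pos) pos∈D mispredicted
        (trans (sym (badness-bits i X pos)) (inClass (suc pos)))
      where
      agrees : prefix X pos ≡ ρ × X pos ≡ b
      agrees = subst (λ m → prefix X m ≡ ρ × X m ≡ b) |ρ|≡pos
        (extends-∷ʳ X ρ b (subst (Extends X) (sym (++-assoc σ padding (b ∷ []))) ext))
      mispredicted : ¬ π P pos (bits X pos) ≡ b2n (X pos)
      mispredicted = subst₂ (λ s x → ¬ π P pos (map b2n s) ≡ b2n x) (sym (proj₁ agrees)) (sym (proj₂ agrees))
        (contradict-differs (π P pos (map b2n ρ)))

mainTheorem2 : (A : ℕ → Bool) → PredictionDegree A → WeaklyMeagerEngulfing A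
mainTheorem2 A (P , P-computable , predictsComputable) =
  ComputableReal , (classes , covered) , λ _ X-computable → X-computable
  where
  open Engulfing A P P-computable

  ComputableReal : (ℕ → Bool) → Set
  ComputableReal X = Computable (charSeq X)

  classes : NDSeq A
  classes = record { R = badness ; R-comp = badness-computable ; nd = nowhereDense }

  covered : ∀ X → ComputableReal X → ∃[ i ] Class badness i X
  covered X X-computable = predicted⇒covered X (predictsComputable (charSeq X) X-computable)
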